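{- Every 4-connected $\{Z_1,K_{1,3}\}$-free graph contains an $H^2$.
   Context: All graphs are finite and simple. $K_{1,3}$ is the claw. $Z_1$ is the graph obtained from $K_{1,3}$ by adding one edge between two of its leaves. A graph is $\{Z_1,K_{1,3}\}$-free if it has no induced subgraph isomorphic to $Z_1$ or $K_{1,3}$. The square of a graph is obtained by adding edges joining all pairs of vertices at distance two. A graph $G$ contains an $H^2$ if $G$ contains, as a subgraph, the square of some hamiltonian cycle of $G$. -}

module Defs where

open import Data.Nat using (ℕ; _+_; _<_)
open import Data.Fin using (Fin; toℕ)
open import Data.Fin.Subset using (Subset; _∈_; _∉_; ∣_∣)
open import Data.Fin.Permutation using (Permutation′; _⟨$⟩ʳ_)
open import Data.Product using (Σ; _×_)
open import Data.Sum using (_⊎_)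
open import Relation.Nullary using (¬_; Dec)
open import Relation.Binary.PropositionalEquality using (_≡_; _≢_)

record Graph : Set₁ where
  field
    n      : ℕ
    Adj    : Fin n → Fin n → Set
    adj?   : ∀ u v → Dec (Adj u v)
    sym    : ∀ {u v} → Adj u v → Adj v u
    irrefl : ∀ u → ¬ Adj u u
open Graph public

data Reach (G : Graph) (S : Subset (n G)) : Fin (n G) → Fin (n G) → Set where
  here : ∀ {u} → u ∉ S → Reach G S u u
  step : ∀ {u v w} → u ∉ S → Adj G u v → Reach G S v w → Reach G S u w

ConnectedAvoiding : (G : Graph) → Subset (n G) → Set
ConnectedAvoiding G S = ∀ u v → u ∉ S → v ∉ S → Reach G S u v

KConnected : ℕ → Graph → Set
KConnected k G = (k < n G) × (∀ (S : Subset (n G)) → ∣ S ∣ < k → ConnectedAvoiding G S)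

InducedClaw : (G : Graph) → Fin (n G) → Fin (n G) → Fin (n G) → Fin (n G) → Set
InducedClaw G a b c d =
  (b ≢ c) × (b ≢ d) × (c ≢ d) ×
  Adj G a b × Adj G a c × Adj G a d ×
  ¬ Adj G b c × ¬ Adj G b d × ¬ Adj G c d

InducedZ1 : (G : Graph) → Fin (n G) → Fin (n G) → Fin (n G) → Fin (n G) → Set
InducedZ1 G a b c d =
  (b ≢ c) × (b ≢ d) × (c ≢ d) ×
  Adj G a b × Adj G a c × Adj G a d ×
  Adj G b c × ¬ Adj G b d × ¬ Adj G c d

ClawFree : Graph → Set
ClawFree G = ∀ a b c d → ¬ InducedClaw G a b c d

Z1Free : Graph → Set
Z1Free G = ∀ a b c d → ¬ InducedZ1 G a b c d

-- toℕ j is toℕ i + k modulo n (for k < n, i, j < n).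
CyclicSucc : ∀ {m} → ℕ → Fin m → Fin m → Set
CyclicSucc {m} k i j = (toℕ i + k ≡ toℕ j) ⊎ (toℕ i + k ≡ toℕ j + m)

-- G contains the square of a hamiltonian cycle: a cyclic ordering σ(0),…,σ(n-1)
-- of all vertices (a permutation) such that vertices at cyclic distance 1 or 2 are adjacent.
ContainsH² : Graph → Set
ContainsH² G =
  Σ (Permutation′ (n G)) λ σ →
    ∀ (i j : Fin (n G)) → (CyclicSucc 1 i j ⊎ CyclicSucc 2 i j) →
      Adj G (σ ⟨$⟩ʳ i) (σ ⟨$⟩ʳ j)

module Submission where

-- In a 3-connected graph that is claw-free and Z₁-free, whenever
-- a vertex sees three others of which two are non-adjacent, the third sees
-- both of them.  From this one shows that a non-neighbour v of u has
-- N(v) ⊆ N(u) (walking from u to v), hence no vertex has two non-neighbours: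
-- G is a complete graph minus a matching, described by an involution
-- `partner`.  With 4-connectivity, a graph on five vertices is complete, so a
-- non-trivial matching forces at least six vertices.
--
-- For an involution p of Fin M (M ≥ 3, and M ≥ 6 if p is not
-- the identity) list the vertices as  Lower ++ A ++ Upper ++ B, where Lower
-- holds the smaller vertex of each pair, Upper their partners in the same
-- order, and the fixed points are split into A and B so that both halves
-- have at least three elements.  Partners then sit at cyclic distance ≥ 3,
-- so vertices at cyclic distance 1 or 2 are distinct and not partners,
-- i.e. adjacent in G.

open import Defs
open import Data.Nat using (ℕ; suc; _+_; _∸_; _≤_; _<_; z≤n; s≤s; _⊓_)
open import Data.Nat.Properties as ℕP using ()
open import Data.Nat.Tactic.RingSolver using (solve-∀)
open import Data.Fin as F using (Fin; toℕ)
open import Data.Fin.Properties as FP using (_≟_)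
open import Data.Fin.Subset as Sub using (Subset; ⁅_⁆; _∪_; ∁; ∣_∣; inside; outside; ⊥)
open import Data.Fin.Subset.Properties as SubP using ()
open import Data.Vec.Base using ([]; _∷_)
open import Data.Fin.Permutation using (Permutation′; _⟨$⟩ʳ_; permutation)
open import Data.Product using (Σ; _×_; _,_; proj₁; proj₂; ∃)
open import Data.Sum using (_⊎_; inj₁; inj₂)
open import Data.Empty using (⊥-elim) renaming (⊥ to Empty)
open import Function using (_∘_)
open import Relation.Nullary using (¬_; yes; no)
open import Relation.Nullary.Decidable using (¬?; _×-dec_; decidable-stable)
open import Relation.Binary.PropositionalEquality
  using (_≡_; _≢_; refl; trans; cong; cong₂; subst; ≢-sym; module ≡-Reasoning)
  renaming (sym to ≡-sym)
open import Relation.Binary.Definitions using (tri<; tri≈; tri>)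
open import Data.List.Base using (List; []; _∷_; _++_; map; filter; take; drop; length; allFin; lookup)
open import Data.List.Properties as LP using ()
open import Data.List.Membership.Propositional using (_∈_)
open import Data.List.Membership.Propositional.Properties as MP using ()
open import Data.List.Relation.Unary.Any as Any using (here; there)
open import Data.List.Relation.Unary.All as All using ()
open import Data.List.Relation.Unary.AllPairs using (_∷_)
open import Data.List.Relation.Unary.Unique.Propositional using (Unique)
open import Data.List.Relation.Unary.Unique.Propositional.Properties as UP using ()
open import Data.List.Relation.Binary.Disjoint.Propositional using (Disjoint)

data At {A : Set} : List A → ℕ → A → Set where
  at0 : ∀ {x xs} → At (x ∷ xs) 0 x
  atS : ∀ {x y xs i} → At xs i y → At (x ∷ xs) (suc i) y

module _ {A : Set} where

  at-++ˡ : ∀ {xs ys : List A} {i x} → At xs i x → At (xs ++ ys) i x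
  at-++ˡ at0      = at0
  at-++ˡ (atS a) = atS (at-++ˡ a)

  at-++ʳ : ∀ (xs : List A) {ys j y} → At ys j y → At (xs ++ ys) (length xs + j) y
  at-++ʳ []       a = a
  at-++ʳ (x ∷ xs) a = atS (at-++ʳ xs a)

  at-++⁻ : ∀ (xs : List A) {ys i x} → At (xs ++ ys) i x →
           At xs i x ⊎ ∃ λ j → i ≡ length xs + j × At ys j x
  at-++⁻ []       a       = inj₂ (_ , refl , a)
  at-++⁻ (x ∷ xs) at0     = inj₁ at0
  at-++⁻ (x ∷ xs) (atS a) with at-++⁻ xs a
  ... | inj₁ b           = inj₁ (atS b)
  ... | inj₂ (j , e , b) = inj₂ (j , cong suc e , b)

  at-functional : ∀ {xs : List A} {i x y} → At xs i x → At xs i y → x ≡ y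
  at-functional at0     at0     = refl
  at-functional (atS a) (atS b) = at-functional a b

  at-∈ : ∀ {xs : List A} {i x} → At xs i x → x ∈ xs
  at-∈ at0     = here refl
  at-∈ (atS a) = there (at-∈ a)

  at-< : ∀ {xs : List A} {i x} → At xs i x → i < length xs
  at-< at0     = s≤s z≤n
  at-< (atS a) = s≤s (at-< a)

  at-injective : ∀ {xs : List A} {i j x} → Unique xs → At xs i x → At xs j x → i ≡ j
  at-injective _       at0     at0     = refl
  at-injective (h ∷ _) at0     (atS b) = ⊥-elim (All.lookup h (at-∈ b) refl)
  at-injective (h ∷ _) (atS a) at0     = ⊥-elim (All.lookup h (at-∈ a) refl)
  at-injective (_ ∷ u) (atS a) (atS b) = cong suc (at-injective u a b)

  lookup-at : ∀ (xs : List A) (i : Fin (length xs)) → At xs (toℕ i) (lookup xs i)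
  lookup-at (x ∷ xs) F.zero    = at0
  lookup-at (x ∷ xs) (F.suc i) = atS (lookup-at xs i)

  index-at : ∀ {xs : List A} {x} (x∈xs : x ∈ xs) → At xs (toℕ (Any.index x∈xs)) x
  index-at (here refl) = at0
  index-at (there x∈xs) = atS (index-at x∈xs)

  unique-++⇒disjoint : ∀ (xs : List A) {ys} → Unique (xs ++ ys) → Disjoint xs ys
  unique-++⇒disjoint (x ∷ xs) (h ∷ _) (here refl , y) = All.lookup h (MP.∈-++⁺ʳ xs y) refl
  unique-++⇒disjoint (x ∷ xs) (_ ∷ u) (there x′ , y)  = unique-++⇒disjoint xs u (x′ , y)

module _ {A B : Set} (f : A → B) where

  at-map : ∀ {xs i x} → At xs i x → At (map f xs) i (f x)
  at-map at0     = at0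
  at-map (atS a) = atS (at-map a)

  at-map⁻ : ∀ {xs i y} → At (map f xs) i y → ∃ λ x → At xs i x × y ≡ f x
  at-map⁻ {x ∷ xs} at0     = x , at0 , refl
  at-map⁻ {x ∷ xs} (atS a) with at-map⁻ a
  ... | z , b , e = z , atS b , e

module Enumeration {M : ℕ} (xs : List (Fin M)) (unique : Unique xs) (complete : ∀ v → v ∈ xs) where

  enumeration-length : length xs ≡ M
  enumeration-length = ℕP.≤-antisym (FP.injective⇒≤ lookup-injective) (FP.injective⇒≤ index-injective)
    where
    lookup-injective : ∀ {i j} → lookup xs i ≡ lookup xs j → i ≡ j
    lookup-injective {i} {j} e = FP.toℕ-injective
      (at-injective unique (lookup-at xs i) (subst (At xs (toℕ j)) (≡-sym e) (lookup-at xs j)))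
    index-injective : ∀ {u v} → Any.index (complete u) ≡ Any.index (complete v) → u ≡ v
    index-injective {u} {v} e = at-functional (index-at (complete u))
      (subst (λ q → At xs (toℕ q) v) (≡-sym e) (index-at (complete v)))

  enumeration-permutation : Σ (Permutation′ M) λ σ → ∀ i → At xs (toℕ i) (σ ⟨$⟩ʳ i)
  enumeration-permutation =
    permutation entry position
      (λ v → at-functional (at-entry (position v)) (at-position v))
      (λ i → FP.toℕ-injective (at-injective unique (at-position (entry i)) (at-entry i)))
    , at-entry
    where
    entry : Fin M → Fin M
    entry i = lookup xs (F.cast (≡-sym enumeration-length) i)
    position : Fin M → Fin M
    position v = F.cast enumeration-length (Any.index (complete v))
    at-entry : ∀ i → At xs (toℕ i) (entry i)
    at-entry i = subst (λ q → At xs q (entry i)) (FP.toℕ-cast (≡-sym enumeration-length) i)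
                   (lookup-at xs (F.cast (≡-sym enumeration-length) i))
    at-position : ∀ v → At xs (toℕ (position v)) v
    at-position v = subst (λ q → At xs q v) (≡-sym (FP.toℕ-cast enumeration-length (Any.index (complete v))))
                      (index-at (complete v))

StepsApart : ℕ → ℕ → ℕ → ℕ → Set
StepsApart L c I J = (I + c ≡ J) ⊎ (I + c ≡ J + L)

DistanceApart : ℕ → ℕ → ℕ → Set
DistanceApart d I J = ∃ λ a → (I ≡ a × J ≡ d + a) ⊎ (I ≡ d + a × J ≡ a)

steps-apart-distinct : ∀ {L c I J} → 0 < c → c < L → StepsApart L c I J → I ≢ J
steps-apart-distinct {L} {c} {I} 0<c _ (inj₁ e) refl =
  ℕP.<-irrefl (ℕP.+-identityʳ I) (subst (I + 0 <_) e (ℕP.+-monoʳ-< I 0<c))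
steps-apart-distinct {L} {c} {I} _ c<L (inj₂ e) refl =
  ℕP.<-irrefl (ℕP.+-cancelˡ-≡ I c L e) c<L

steps-apart-not-distance : ∀ {L c d I J} → c ≤ 2 → 3 ≤ d → d + 3 ≤ L →
                           StepsApart L c I J → ¬ DistanceApart d I J
steps-apart-not-distance {L} {c} {d} c≤2 3≤d d+3≤L steps (a , inj₁ (refl , refl)) with steps
... | inj₁ e = ℕP.<-irrefl (ℕP.+-cancelˡ-≡ a c d (trans e (ℕP.+-comm d a)))
                 (ℕP.<-≤-trans (s≤s c≤2) 3≤d)
... | inj₂ e = ℕP.<-irrefl e (ℕP.+-mono-≤-< (ℕP.m≤n+m a d) c<L)
  where
  c<L : c < L
  c<L = ℕP.≤-trans (s≤s c≤2) (ℕP.≤-trans 3≤d (ℕP.≤-trans (ℕP.m≤m+n d 3) d+3≤L))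
steps-apart-not-distance {L} {c} {d} c≤2 3≤d d+3≤L steps (a , inj₂ (refl , refl)) with steps
... | inj₁ e = ℕP.<-irrefl (≡-sym e) (ℕP.<-≤-trans (ℕP.m<n+m a (ℕP.<-≤-trans (s≤s z≤n) 3≤d))
                                                   (ℕP.m≤m+n (d + a) c))
... | inj₂ e = ℕP.<-irrefl (ℕP.+-cancelˡ-≡ a (d + c) L (trans (rearrange d a c) e))
                 (ℕP.<-≤-trans (ℕP.+-monoʳ-< d (s≤s c≤2)) d+3≤L)
  where
  rearrange : ∀ x y z → y + (x + z) ≡ (x + y) + z
  rearrange = solve-∀

-- Moving 3 ∸ k of m fixed points to the first half of k + m + k ≥ 6
-- positions leaves at least three positions in each half.
balanced-halves : ∀ k m → 0 < k → 6 ≤ k + (k + m) →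
                  3 ≤ k + ((3 ∸ k) ⊓ m) × 3 ≤ k + (m ∸ (3 ∸ k))
balanced-halves 1 (suc (suc (suc (suc m)))) _ _ = s≤s (s≤s (s≤s z≤n)) , s≤s (s≤s (s≤s z≤n))
balanced-halves 1 0 _ (s≤s (s≤s ()))
balanced-halves 1 1 _ (s≤s (s≤s (s≤s ())))
balanced-halves 1 2 _ (s≤s (s≤s (s≤s (s≤s ()))))
balanced-halves 1 3 _ (s≤s (s≤s (s≤s (s≤s (s≤s ())))))
balanced-halves 2 (suc (suc m)) _ _ = s≤s (s≤s (s≤s z≤n)) , s≤s (s≤s (s≤s z≤n))
balanced-halves 2 0 _ (s≤s (s≤s (s≤s (s≤s ()))))
balanced-halves 2 1 _ (s≤s (s≤s (s≤s (s≤s (s≤s ())))))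
balanced-halves (suc (suc (suc k))) m _ _ = s≤s (s≤s (s≤s z≤n)) , s≤s (s≤s (s≤s z≤n))

module InvolutionOrder {M : ℕ} (p : Fin M → Fin M) (involutive : ∀ u → p (p u) ≡ u)
                       (3≤M : 3 ≤ M) (room : ∀ u → p u ≢ u → 6 ≤ M) where

  Lower Upper Fixed : List (Fin M)
  Lower = filter (λ u → u FP.<? p u) (allFin M)
  Upper = map p Lower
  Fixed = filter (λ u → p u ≟ u) (allFin M)

  k : ℕ
  k = length Lower

  -- Fixed points are split so that each half of the order has ≥ 3 entries.
  A B : List (Fin M)
  A = take (3 ∸ k) Fixed
  B = drop (3 ∸ k) Fixed

  order : List (Fin M)
  order = Lower ++ A ++ Upper ++ B

  -- The position of a vertex in Lower and of its partner in Upper differ by d.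
  d : ℕ
  d = k + length A

  p-injective : ∀ {x y} → p x ≡ p y → x ≡ y
  p-injective {x} {y} e = trans (≡-sym (involutive x)) (trans (cong p e) (involutive y))

  lower⁻ : ∀ {v} → v ∈ Lower → v F.< p v
  lower⁻ v∈ = proj₂ (MP.∈-filter⁻ (λ u → u FP.<? p u) {xs = allFin M} v∈)

  lower⁺ : ∀ {v} → v F.< p v → v ∈ Lower
  lower⁺ {v} = MP.∈-filter⁺ (λ u → u FP.<? p u) (MP.∈-allFin v)

  upper⁻ : ∀ {v} → v ∈ Upper → p v F.< v
  upper⁻ v∈ with MP.∈-map⁻ p v∈
  ... | z , z∈ , refl = subst (F._< p z) (≡-sym (involutive z)) (lower⁻ z∈)

  upper⁺ : ∀ {v} → p v F.< v → v ∈ Upper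
  upper⁺ {v} pv<v = subst (_∈ Upper) (involutive v)
    (MP.∈-map⁺ p (lower⁺ (subst (p v F.<_) (≡-sym (involutive v)) pv<v)))

  fixed⁻ : ∀ {v} → v ∈ Fixed → p v ≡ v
  fixed⁻ v∈ = proj₂ (MP.∈-filter⁻ (λ u → p u ≟ u) {xs = allFin M} v∈)

  A++B≡Fixed : A ++ B ≡ Fixed
  A++B≡Fixed = LP.take++drop≡id (3 ∸ k) Fixed

  A⊆Fixed : ∀ {v} → v ∈ A → v ∈ Fixed
  A⊆Fixed v∈ = subst (_ ∈_) A++B≡Fixed (MP.∈-++⁺ˡ v∈)

  B⊆Fixed : ∀ {v} → v ∈ B → v ∈ Fixed
  B⊆Fixed v∈ = subst (_ ∈_) A++B≡Fixed (MP.∈-++⁺ʳ A v∈)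

  Fixed-unique : Unique Fixed
  Fixed-unique = UP.filter⁺ (λ u → p u ≟ u) (UP.allFin⁺ M)

  lower-not-fixed : ∀ {v} → v F.< p v → p v ≢ v
  lower-not-fixed v<pv e = FP.<-irrefl (≡-sym e) v<pv

  upper-not-fixed : ∀ {v} → p v F.< v → p v ≢ v
  upper-not-fixed pv<v e = FP.<-irrefl e pv<v

  order-unique : Unique order
  order-unique =
    UP.++⁺ (UP.filter⁺ _ (UP.allFin⁺ M))
      (UP.++⁺ (UP.take⁺ (3 ∸ k) Fixed-unique)
        (UP.++⁺ (UP.map⁺ p-injective (UP.filter⁺ _ (UP.allFin⁺ M))) (UP.drop⁺ (3 ∸ k) Fixed-unique) Upper#B)
        A#Upper++B)
      Lower#rest
    where
    Upper#B : Disjoint Upper B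
    Upper#B (u , b) = upper-not-fixed (upper⁻ u) (fixed⁻ (B⊆Fixed b))
    A#Upper++B : Disjoint A (Upper ++ B)
    A#Upper++B (a , x) with MP.∈-++⁻ Upper x
    ... | inj₁ u = upper-not-fixed (upper⁻ u) (fixed⁻ (A⊆Fixed a))
    ... | inj₂ b = unique-++⇒disjoint A (subst Unique (≡-sym A++B≡Fixed) Fixed-unique) (a , b)
    Lower#rest : Disjoint Lower (A ++ Upper ++ B)
    Lower#rest (l , x) with MP.∈-++⁻ A x
    ... | inj₁ a = lower-not-fixed (lower⁻ l) (fixed⁻ (A⊆Fixed a))
    ... | inj₂ y with MP.∈-++⁻ Upper y
    ... | inj₁ u = FP.<-asym (lower⁻ l) (upper⁻ u)
    ... | inj₂ b = lower-not-fixed (lower⁻ l) (fixed⁻ (B⊆Fixed b))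

  order-complete : ∀ v → v ∈ order
  order-complete v with FP.<-cmp v (p v)
  ... | tri< v<pv _ _ = MP.∈-++⁺ˡ (lower⁺ v<pv)
  ... | tri> _ _ pv<v = MP.∈-++⁺ʳ Lower (MP.∈-++⁺ʳ A (MP.∈-++⁺ˡ (upper⁺ pv<v)))
  ... | tri≈ _ v≡pv _ with MP.∈-++⁻ A (subst (v ∈_) (≡-sym A++B≡Fixed) v∈Fixed)
    where
    v∈Fixed : v ∈ Fixed
    v∈Fixed = MP.∈-filter⁺ (λ u → p u ≟ u) (MP.∈-allFin v) (≡-sym v≡pv)
  ... | inj₁ a = MP.∈-++⁺ʳ Lower (MP.∈-++⁺ˡ a)
  ... | inj₂ b = MP.∈-++⁺ʳ Lower (MP.∈-++⁺ʳ A (MP.∈-++⁺ʳ Upper b))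

  open Enumeration order order-unique order-complete

  partner-positions : ∀ {i j x} → At order i x → At order j (p x) → p x ≢ x →
                      0 < k × DistanceApart d i j
  partner-positions {i} {j} {x} at-x at-px px≢x with at-++⁻ Lower at-x
  ... | inj₁ in-lower = ℕP.<-≤-trans (s≤s z≤n) (at-< in-lower)
                      , i , inj₁ (refl , at-injective order-unique at-px at-px′)
    where
    at-px′ : At order (d + i) (p x)
    at-px′ = subst (λ q → At order q (p x)) (≡-sym (ℕP.+-assoc k (length A) i))
               (at-++ʳ Lower (at-++ʳ A (at-++ˡ (at-map p in-lower))))
  ... | inj₂ (i₁ , i≡ , at-rest) with at-++⁻ A at-rest
  ... | inj₁ in-A = ⊥-elim (px≢x (fixed⁻ (A⊆Fixed (at-∈ in-A))))
  ... | inj₂ (i₂ , i₁≡ , at-rest′) with at-++⁻ Upper at-rest′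
  ... | inj₂ (_ , _ , in-B) = ⊥-elim (px≢x (fixed⁻ (B⊆Fixed (at-∈ in-B))))
  ... | inj₁ in-upper with at-map⁻ p in-upper
  ... | z , at-z , refl =
    ℕP.<-≤-trans (s≤s z≤n) (at-< at-z) , i₂ ,
    inj₂ ( trans i≡ (trans (cong (k +_) i₁≡) (≡-sym (ℕP.+-assoc k (length A) i₂)))
         , at-injective order-unique at-px (subst (At order i₂) (≡-sym (involutive z)) (at-++ˡ at-z)))

  halves : M ≡ d + (k + length B)
  halves = begin
    M                                          ≡⟨ ≡-sym enumeration-length ⟩
    length order                               ≡⟨ LP.length-++ Lower ⟩
    k + length (A ++ Upper ++ B)               ≡⟨ cong (k +_) (LP.length-++ A) ⟩
    k + (length A + length (Upper ++ B))       ≡⟨ cong (λ q → k + (length A + q)) (LP.length-++ Upper) ⟩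
    k + (length A + (length Upper + length B)) ≡⟨ cong (λ q → k + (length A + (q + length B))) (LP.length-map p Lower) ⟩
    k + (length A + (k + length B))            ≡⟨ ≡-sym (ℕP.+-assoc k (length A) (k + length B)) ⟩
    d + (k + length B)                         ∎
    where open ≡-Reasoning

  distance-bounds : 0 < k → 6 ≤ M → 3 ≤ d × d + 3 ≤ M
  distance-bounds 0<k 6≤M =
      subst (λ q → 3 ≤ k + q) (≡-sym (LP.length-take (3 ∸ k) Fixed)) (proj₁ bounds)
    , subst (d + 3 ≤_) (≡-sym halves)
        (ℕP.+-monoʳ-≤ d (subst (λ q → 3 ≤ k + q) (≡-sym (LP.length-drop (3 ∸ k) Fixed)) (proj₂ bounds)))
    where
    M≡ : M ≡ k + (k + length Fixed)
    M≡ = begin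
      M                                      ≡⟨ halves ⟩
      (k + length A) + (k + length B)        ≡⟨ shuffle k (length A) (length B) ⟩
      k + (k + (length A + length B))        ≡⟨ cong (λ q → k + (k + q)) (≡-sym (LP.length-++ A)) ⟩
      k + (k + length (A ++ B))              ≡⟨ cong (λ q → k + (k + length q)) A++B≡Fixed ⟩
      k + (k + length Fixed)                 ∎
      where
      open ≡-Reasoning
      shuffle : ∀ x y z → (x + y) + (x + z) ≡ x + (x + (y + z))
      shuffle = solve-∀
    bounds : 3 ≤ k + ((3 ∸ k) ⊓ length Fixed) × 3 ≤ k + (length Fixed ∸ (3 ∸ k))
    bounds = balanced-halves k (length Fixed) 0<k (subst (6 ≤_) M≡ 6≤M)

  square-order : Σ (Permutation′ M) λ σ → ∀ i j → CyclicSucc 1 i j ⊎ CyclicSucc 2 i j →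
                 σ ⟨$⟩ʳ j ≢ σ ⟨$⟩ʳ i × σ ⟨$⟩ʳ j ≢ p (σ ⟨$⟩ʳ i)
  square-order = σ , λ { i j (inj₁ steps) → separated (s≤s z≤n) (s≤s z≤n) steps
                       ; i j (inj₂ steps) → separated (s≤s z≤n) (s≤s (s≤s z≤n)) steps }
    where
    σ : Permutation′ M
    σ = proj₁ enumeration-permutation
    at-σ : ∀ i → At order (toℕ i) (σ ⟨$⟩ʳ i)
    at-σ = proj₂ enumeration-permutation
    separated : ∀ {c i j} → 0 < c → c ≤ 2 → StepsApart M c (toℕ i) (toℕ j) →
                σ ⟨$⟩ʳ j ≢ σ ⟨$⟩ʳ i × σ ⟨$⟩ʳ j ≢ p (σ ⟨$⟩ʳ i)
    separated {c} {i} {j} 0<c c≤2 steps = distinct , not-partner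
      where
      distinct : σ ⟨$⟩ʳ j ≢ σ ⟨$⟩ʳ i
      distinct e = steps-apart-distinct 0<c (ℕP.<-≤-trans (s≤s c≤2) 3≤M) steps
        (at-injective order-unique (at-σ i) (subst (At order (toℕ j)) e (at-σ j)))
      not-partner : σ ⟨$⟩ʳ j ≢ p (σ ⟨$⟩ʳ i)
      not-partner e with p (σ ⟨$⟩ʳ i) ≟ σ ⟨$⟩ʳ i
      ... | yes fixed = distinct (trans e fixed)
      ... | no moved with partner-positions (at-σ i) (subst (At order (toℕ j)) e (at-σ j)) moved
      ... | 0<k , apart with distance-bounds 0<k (room (σ ⟨$⟩ʳ i) moved)
      ... | 3≤d , d+3≤M = steps-apart-not-distance c≤2 3≤d d+3≤M steps apart

∣p∪q∣≤∣p∣+∣q∣ : ∀ {m} (p q : Subset m) → ∣ p ∪ q ∣ ≤ ∣ p ∣ + ∣ q ∣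
∣p∪q∣≤∣p∣+∣q∣ []            []            = z≤n
∣p∪q∣≤∣p∣+∣q∣ (inside ∷ p)  (inside ∷ q)  =
  s≤s (ℕP.≤-trans (∣p∪q∣≤∣p∣+∣q∣ p q) (ℕP.≤-trans (ℕP.n≤1+n _) (ℕP.≤-reflexive (≡-sym (ℕP.+-suc _ _)))))
∣p∪q∣≤∣p∣+∣q∣ (inside ∷ p)  (outside ∷ q) = s≤s (∣p∪q∣≤∣p∣+∣q∣ p q)
∣p∪q∣≤∣p∣+∣q∣ (outside ∷ p) (inside ∷ q)  =
  ℕP.≤-trans (s≤s (∣p∪q∣≤∣p∣+∣q∣ p q)) (ℕP.≤-reflexive (≡-sym (ℕP.+-suc _ _)))
∣p∪q∣≤∣p∣+∣q∣ (outside ∷ p) (outside ∷ q) = ∣p∪q∣≤∣p∣+∣q∣ p q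

missing-element : ∀ {m} (S : Subset m) → ∣ S ∣ < m → ∃ λ z → z Sub.∉ S
missing-element {m} S ∣S∣<m with SubP.nonempty? (∁ S)
... | yes (z , z∈∁S) = z , SubP.x∈∁p⇒x∉p z∈∁S
... | no ∁S-empty    = ⊥-elim (ℕP.<-irrefl (≡-sym ∣∁S∣≡0) (ℕP.m<n⇒0<n∸m ∣S∣<m))
  where
  ∣∁S∣≡0 : m ∸ ∣ S ∣ ≡ 0
  ∣∁S∣≡0 = trans (≡-sym (SubP.∣∁p∣≡n∸∣p∣ S)) (trans (cong ∣_∣ (SubP.Empty-unique ∁S-empty)) (SubP.∣⊥∣≡0 m))

pair : ∀ {m} → Fin m → Fin m → Subset m
pair u v = ⁅ u ⁆ ∪ ⁅ v ⁆

∣pair∣≤2 : ∀ {m} (u v : Fin m) → ∣ pair u v ∣ ≤ 2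
∣pair∣≤2 u v = ℕP.≤-trans (∣p∪q∣≤∣p∣+∣q∣ ⁅ u ⁆ ⁅ v ⁆) (ℕP.≤-reflexive (cong₂ _+_ (SubP.∣⁅x⁆∣≡1 u) (SubP.∣⁅x⁆∣≡1 v)))

2≤∣pair∣ : ∀ {m} {u v : Fin m} → u ≢ v → 2 ≤ ∣ pair u v ∣
2≤∣pair∣ {u = u} {v} u≢v = subst (λ c → suc c ≤ ∣ pair u v ∣) (SubP.∣⁅x⁆∣≡1 u)
  (SubP.p⊂q⇒∣p∣<∣q∣ ( SubP.p⊆p∪q ⁅ v ⁆ , v , SubP.x∈p∪q⁺ (inj₂ (SubP.x∈⁅x⁆ v))
                    , λ v∈⁅u⁆ → u≢v (≡-sym (SubP.x∈⁅y⁆⇒x≡y u v∈⁅u⁆))))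

∈pair⁻ : ∀ {m} {u v w : Fin m} → w Sub.∈ pair u v → w ≡ u ⊎ w ≡ v
∈pair⁻ {u = u} {v} w∈ with SubP.x∈p∪q⁻ ⁅ u ⁆ ⁅ v ⁆ w∈
... | inj₁ w∈⁅u⁆ = inj₁ (SubP.x∈⁅y⁆⇒x≡y u w∈⁅u⁆)
... | inj₂ w∈⁅v⁆ = inj₂ (SubP.x∈⁅y⁆⇒x≡y v w∈⁅v⁆)

∉pair⁺ : ∀ {m} {u v w : Fin m} → w ≢ u → w ≢ v → w Sub.∉ pair u v
∉pair⁺ w≢u w≢v w∈ with ∈pair⁻ w∈
... | inj₁ w≡u = w≢u w≡u
... | inj₂ w≡v = w≢v w≡v

∉pair⁻ : ∀ {m} {u v w : Fin m} → w Sub.∉ pair u v → w ≢ u × w ≢ v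
∉pair⁻ {w = w} w∉ = (λ { refl → w∉ (SubP.x∈p∪q⁺ (inj₁ (SubP.x∈⁅x⁆ w))) })
                  , (λ { refl → w∉ (SubP.x∈p∪q⁺ (inj₂ (SubP.x∈⁅x⁆ w))) })

reach-start-outside : ∀ {G S a b} → Reach G S a b → a Sub.∉ S
reach-start-outside (here a∉S)     = a∉S
reach-start-outside (step a∉S _ _) = a∉S

k-connected-mono : ∀ {k l G} → k ≤ l → KConnected l G → KConnected k G
k-connected-mono k≤l (l<n , conn) = ℕP.≤-<-trans k≤l l<n , λ S ∣S∣<k → conn S (ℕP.<-≤-trans ∣S∣<k k≤l)

-- A 4-connected graph on five vertices is complete: removing the three
-- vertices other than u and v would otherwise separate u from v.
five-vertices-complete : ∀ {G} → KConnected 4 G → n G ≡ 5 → ∀ u v → u ≢ v → Adj G u v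
five-vertices-complete {G} (_ , conn) n≡5 u v u≢v =
  decidable-stable (adj? G u v) λ u≁v → separated u≁v (conn S ∣S∣<4 u v (outside-S u∈X) (outside-S v∈X))
  where
  X S : Subset (n G)
  X = pair u v
  S = ∁ X
  u∈X : u Sub.∈ X
  u∈X = SubP.x∈p∪q⁺ (inj₁ (SubP.x∈⁅x⁆ u))
  v∈X : v Sub.∈ X
  v∈X = SubP.x∈p∪q⁺ (inj₂ (SubP.x∈⁅x⁆ v))
  outside-S : ∀ {w} → w Sub.∈ X → w Sub.∉ S
  outside-S = SubP.x∈p⇒x∉∁p
  ∣S∣<4 : ∣ S ∣ < 4
  ∣S∣<4 = subst (_< 4) (≡-sym (SubP.∣∁p∣≡n∸∣p∣ X))
            (subst (λ c → c ∸ ∣ X ∣ < 4) (≡-sym n≡5) (s≤s (ℕP.∸-monoʳ-≤ 5 (2≤∣pair∣ u≢v))))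
  separated : ¬ Adj G u v → Reach G S u v → Empty
  separated _   (here _)        = u≢v refl
  separated u≁v (step _ u~w w→v) with ∈pair⁻ (SubP.x∉∁p⇒x∈p (reach-start-outside w→v))
  ... | inj₁ refl = irrefl G u u~w
  ... | inj₂ refl = u≁v u~w

record CompleteMinusMatching (G : Graph) : Set where
  field
    partner                 : Fin (n G) → Fin (n G)
    involutive              : ∀ u → partner (partner u) ≡ u
    adjacent-unless-partner : ∀ u v → u ≢ v → v ≢ partner u → Adj G u v
    partner-non-adjacent    : ∀ u → partner u ≢ u → ¬ Adj G u (partner u)

module ThreeConnected (G : Graph) (3-connected : KConnected 3 G) (z1-free : Z1Free G) (claw-free : ClawFree G) where

  V : Set
  V = Fin (n G)

  _~_ : V → V → Set
  _~_ = Adj G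

  ~-sym : ∀ {u v} → u ~ v → v ~ u
  ~-sym = Graph.sym G

  ~⇒≢ : ∀ {u v} → u ~ v → u ≢ v
  ~⇒≢ {u} u~u refl = irrefl G u u~u

  connected-avoiding : ∀ (S : Subset (n G)) → ∣ S ∣ < 3 → ConnectedAvoiding G S
  connected-avoiding = proj₂ 3-connected

  connected : ∀ u v → Reach G ⊥ u v
  connected u v = connected-avoiding ⊥ (subst (_< 3) (≡-sym (SubP.∣⊥∣≡0 (n G))) (s≤s z≤n)) u v SubP.∉⊥ SubP.∉⊥

  -- If a sees b, c, d and b ≁ c, then d sees both b and c: otherwise a, b,
  -- c, d induce a claw or a Z₁.
  closing-neighbour : ∀ {a b c d} → a ~ b → a ~ c → a ~ d → b ≢ c → b ≢ d → c ≢ d → ¬ b ~ c →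
                      b ~ d × c ~ d
  closing-neighbour {a} {b} {c} {d} a~b a~c a~d b≢c b≢d c≢d b≁c with adj? G b d | adj? G c d
  ... | yes b~d | yes c~d = b~d , c~d
  ... | no b≁d  | no c≁d  = ⊥-elim (claw-free a b c d (b≢c , b≢d , c≢d , a~b , a~c , a~d , b≁c , b≁d , c≁d))
  ... | yes b~d | no c≁d  =
    ⊥-elim (z1-free a b d c (b≢d , b≢c , ≢-sym c≢d , a~b , a~d , a~c , b~d , b≁c , c≁d ∘ ~-sym))
  ... | no b≁d  | yes c~d =
    ⊥-elim (z1-free a c d b (c≢d , ≢-sym b≢c , ≢-sym b≢d , a~c , a~d , a~b , c~d , b≁c ∘ ~-sym , b≁d ∘ ~-sym))

  -- Every vertex x outside {u, v} has a neighbour outside {u, v}, because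
  -- G - {u, v} is connected and contains a vertex other than x.
  neighbour-avoiding : ∀ {x u v} → x ≢ u → x ≢ v → ∃ λ w → x ~ w × w ≢ u × w ≢ v
  neighbour-avoiding {x} {u} {v} x≢u x≢v with missing-element (⁅ x ⁆ ∪ pair u v) ∣S∣<n
    where
    ∣S∣<n : ∣ ⁅ x ⁆ ∪ pair u v ∣ < n G
    ∣S∣<n = ℕP.≤-<-trans
      (ℕP.≤-trans (∣p∪q∣≤∣p∣+∣q∣ ⁅ x ⁆ (pair u v)) (ℕP.+-mono-≤ (ℕP.≤-reflexive (SubP.∣⁅x⁆∣≡1 x)) (∣pair∣≤2 u v)))
      (proj₁ 3-connected)
  ... | z , z∉S = first-step z≢x
        (connected-avoiding (pair u v) (s≤s (∣pair∣≤2 u v)) x z (∉pair⁺ x≢u x≢v) z∉pair)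
    where
    z≢x : z ≢ x
    z≢x refl = z∉S (SubP.x∈p∪q⁺ (inj₁ (SubP.x∈⁅x⁆ z)))
    z∉pair : z Sub.∉ pair u v
    z∉pair z∈ = z∉S (SubP.x∈p∪q⁺ (inj₂ z∈))
    first-step : z ≢ x → Reach G (pair u v) x z → ∃ λ w → x ~ w × w ≢ u × w ≢ v
    first-step z≢x (here _)         = ⊥-elim (z≢x refl)
    first-step _   (step _ x~w w→z) = _ , x~w , ∉pair⁻ (reach-start-outside w→z)

  neighbour-distinct : ∀ {u v y} → ¬ u ~ v → y ~ u → u ≢ y × v ≢ y
  neighbour-distinct u≁v y~u = ≢-sym (~⇒≢ y~u) , λ { refl → u≁v (~-sym y~u) }

  -- Take a neighbour w of x outside {u, v}; it sees u
  -- and v.  If x ~ y, close the triple (u, v, y) at x; otherwise w ~ y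
  -- (closing (x, y, w) at u), and close (u, v, y) at w.
  common-neighbour-transfer : ∀ {u v x y} → u ≢ v → ¬ u ~ v → x ~ u → x ~ v → y ~ u → y ~ v
  common-neighbour-transfer {u} {v} {x} {y} u≢v u≁v x~u x~v y~u
    with neighbour-distinct u≁v y~u | neighbour-avoiding {x} {u} {v} (~⇒≢ x~u) (~⇒≢ x~v)
  ... | u≢y , v≢y | w , x~w , w≢u , w≢v with closing-neighbour x~u x~v x~w u≢v (≢-sym w≢u) (≢-sym w≢v) u≁v
  ... | u~w , v~w with y ≟ x | adj? G x y
  ... | yes refl | _       = x~v
  ... | no y≢x   | yes x~y = ~-sym (proj₂ (closing-neighbour x~u x~v x~y u≢v u≢y v≢y u≁v))
  ... | no y≢x   | no x≁y  = ~-sym (proj₂ (closing-neighbour (~-sym u~w) (~-sym v~w) w~y u≢v u≢y v≢y u≁v))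
    where
    w~y : w ~ y
    w~y = ~-sym (proj₂ (closing-neighbour (~-sym x~u) (~-sym y~u) u~w (≢-sym y≢x) (~⇒≢ x~w)
                                          (λ { refl → x≁y x~w }) x≁y))

  -- The invariant carried along a walk c₀ = u, …, cₙ = v in the proof that
  -- a non-neighbour v of u satisfies N(v) ⊆ N(u).
  Dominated : V → V → Set
  Dominated u c = u ~ c ⊎ (∀ y → c ~ y → u ~ y)

  dominated-step : ∀ {u c c′} → c ~ c′ → Dominated u c → Dominated u c′
  dominated-step c~c′ (inj₂ N[c]⊆N[u]) = inj₁ (N[c]⊆N[u] _ c~c′)
  dominated-step {u} {c} {c′} c~c′ (inj₁ u~c) with adj? G u c′ | u ≟ c′
  ... | yes u~c′ | _        = inj₁ u~c′
  ... | no _     | yes refl = inj₂ (λ y u~y → u~y)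
  ... | no u≁c′  | no u≢c′  = inj₂ (λ y c′~y →
    ~-sym (common-neighbour-transfer (≢-sym u≢c′) (u≁c′ ∘ ~-sym) c~c′ (~-sym u~c) (~-sym c′~y)))

  dominated-walk : ∀ {S u c w} → Reach G S c w → Dominated u c → Dominated u w
  dominated-walk (here _)          dom = dom
  dominated-walk (step _ c~c′ c′→w) dom = dominated-walk c′→w (dominated-step c~c′ dom)

  -- Non-adjacent u, v satisfy N(v) ⊆ N(u): carry `Dominated u` along a walk
  -- from u to v.
  non-neighbour-dominated : ∀ {u v} → ¬ u ~ v → ∀ y → v ~ y → u ~ y
  non-neighbour-dominated {u} {v} u≁v with dominated-walk (connected u v) (inj₂ (λ y u~y → u~y))
  ... | inj₁ u~v         = ⊥-elim (u≁v u~v)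
  ... | inj₂ N[v]⊆N[u] = N[v]⊆N[u]

  -- No vertex has two non-neighbours: a neighbour x of u would see both of
  -- them by domination, and x, u, v, w would form a claw.
  at-most-one-non-neighbour : ∀ {u v w} → u ≢ v → u ≢ w → v ≢ w → ¬ u ~ v → ¬ u ~ w → Empty
  at-most-one-non-neighbour {u} {v} {w} u≢v u≢w v≢w u≁v u≁w with connected u v
  ... | here _                = u≢v refl
  ... | step {v = x} _ u~x _ =
    claw-free x u v w (u≢v , u≢w , v≢w , ~-sym u~x , x~v , x~w , u≁v , u≁w , v≁w)
    where
    x~v : x ~ v
    x~v = ~-sym (non-neighbour-dominated (u≁v ∘ ~-sym) _ u~x)
    x~w : x ~ w
    x~w = ~-sym (non-neighbour-dominated (u≁w ∘ ~-sym) _ u~x)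
    v≁w : ¬ v ~ w
    v≁w v~w = u≁w (non-neighbour-dominated u≁v w v~w)

  data PartnerOf (u : V) : V → Set where
    non-neighbour : ∀ v → v ≢ u → ¬ u ~ v → PartnerOf u v
    universal     : (∀ v → v ≢ u → u ~ v) → PartnerOf u u

  find-partner : ∀ u → Σ V (PartnerOf u)
  find-partner u with FP.any? (λ v → ¬? (v ≟ u) ×-dec ¬? (adj? G u v))
  ... | yes (v , v≢u , u≁v) = v , non-neighbour v v≢u u≁v
  ... | no none = u , universal (λ v v≢u → decidable-stable (adj? G u v) (λ u≁v → none (v , v≢u , u≁v)))

  partner : V → V
  partner u = proj₁ (find-partner u)

  partner-of : ∀ u → PartnerOf u (partner u)
  partner-of u = proj₂ (find-partner u)

  adjacent-or-partner : ∀ u v → u ≢ v → u ~ v ⊎ v ≡ partner u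
  adjacent-or-partner u v u≢v with adj? G u v | partner u | partner-of u
  ... | yes u~v | _  | _ = inj₁ u~v
  ... | no u≁v | .u | universal all = ⊥-elim (u≁v (all v (≢-sym u≢v)))
  ... | no u≁v | .w | non-neighbour w w≢u u≁w with v ≟ w
  ... | yes v≡w = inj₂ v≡w
  ... | no v≢w  = ⊥-elim (at-most-one-non-neighbour u≢v (≢-sym w≢u) v≢w u≁v u≁w)

  universal-fixed : ∀ {u} → (∀ v → v ≢ u → u ~ v) → partner u ≡ u
  universal-fixed {u} all with partner u | partner-of u
  ... | .v | non-neighbour v v≢u u≁v = ⊥-elim (u≁v (all v v≢u))
  ... | .u | universal _             = refl

  partner-involutive : ∀ u → partner (partner u) ≡ u
  partner-involutive u with partner u | partner-of u
  ... | .u | universal all = universal-fixed all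
  ... | .v | non-neighbour v v≢u u≁v with adjacent-or-partner v u v≢u
  ...   | inj₁ v~u = ⊥-elim (u≁v (~-sym v~u))
  ...   | inj₂ u≡p = ≡-sym u≡p

  partner-non-adjacent : ∀ u → partner u ≢ u → ¬ u ~ partner u
  partner-non-adjacent u with partner u | partner-of u
  ... | .v | non-neighbour v _ u≁v = λ _ → u≁v
  ... | .u | universal _           = λ moved → ⊥-elim (moved refl)

  adjacent-unless-partner : ∀ u v → u ≢ v → v ≢ partner u → u ~ v
  adjacent-unless-partner u v u≢v v≢p with adjacent-or-partner u v u≢v
  ... | inj₁ u~v = u~v
  ... | inj₂ v≡p = ⊥-elim (v≢p v≡p)

  complete-minus-matching : CompleteMinusMatching G
  complete-minus-matching = record
    { partner                 = partner
    ; involutive              = partner-involutive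
    ; adjacent-unless-partner = adjacent-unless-partner
    ; partner-non-adjacent    = partner-non-adjacent
    }

-- A 4-connected complete graph minus a non-empty matching has at least six
-- vertices, since on five vertices it is complete.
matching-needs-six : ∀ {G} → KConnected 4 G → (H : CompleteMinusMatching G) →
                     ∀ u → CompleteMinusMatching.partner H u ≢ u → 6 ≤ n G
matching-needs-six {G} 4-connected H u moved with ℕP.m≤n⇒m<n∨m≡n (proj₁ 4-connected)
... | inj₁ 6≤n = 6≤n
... | inj₂ 5≡n = ⊥-elim (CompleteMinusMatching.partner-non-adjacent H u moved
                   (five-vertices-complete 4-connected (≡-sym 5≡n) u _ (moved ∘ ≡-sym)))

square-of-complete-minus-matching : ∀ {G} → 3 ≤ n G → (H : CompleteMinusMatching G) →
  (∀ u → CompleteMinusMatching.partner H u ≢ u → 6 ≤ n G) → ContainsH² G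
square-of-complete-minus-matching {G} 3≤n H room = σ , square-adjacent
  where
  open CompleteMinusMatching H
  open InvolutionOrder partner involutive 3≤n room
  σ : Permutation′ (n G)
  σ = proj₁ square-order
  square-adjacent : ∀ i j → CyclicSucc 1 i j ⊎ CyclicSucc 2 i j → Adj G (σ ⟨$⟩ʳ i) (σ ⟨$⟩ʳ j)
  square-adjacent i j close with proj₂ square-order i j close
  ... | distinct , not-partner = adjacent-unless-partner _ _ (distinct ∘ ≡-sym) not-partner

theorem4 : (G : Graph) → KConnected 4 G → Z1Free G → ClawFree G → ContainsH² G
theorem4 G 4-connected z1-free claw-free =
  square-of-complete-minus-matching 3≤n H (matching-needs-six 4-connected H)
  where
  3-connected : KConnected 3 G
  3-connected = k-connected-mono (ℕP.n≤1+n 3) 4-connected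
  3≤n : 3 ≤ n G
  3≤n = ℕP.<⇒≤ (proj₁ 3-connected)
  H : CompleteMinusMatching G
  H = ThreeConnected.complete-minus-matching G 3-connected z1-free claw-free
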